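{- Let $\alpha$ be a scattered linear ordering and $R$ an equivalence relation on $\alpha$ such that for all subsets $X<Y$ of $\alpha$ with $X^2\subseteq R$ and $Y^2\subseteq R$, if $\bigcap_{x\in X,\,y\in Y}\,]x,y[\;=\emptyset$ then $(X\cup Y)^2\subseteq R$. Then $R=\alpha^2$.
   Context: A linear ordering is dense if between any two distinct elements there is a third; it is scattered if no suborder (subset with induced order) of it with at least two elements is dense. For subsets $X,Y$, $X<Y$ means $x<y$ for all $x\in X$, $y\in Y$. $]x,y[$ denotes the open interval. -}

module Defs where

open import Level using (0ℓ)
open import Data.Product using (Σ; ∃; _×_)
open import Data.Sum using (_⊎_)
open import Relation.Nullary using (¬_)
open import Relation.Binary using (Rel; IsStrictTotalOrder; IsEquivalence)
open import Relation.Binary.PropositionalEquality using (_≡_; _≢_)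

Subset : Set → Set₁
Subset A = A → Set

module _ {A : Set} (_<_ : Rel A 0ℓ) where

  DenseSub : Subset A → Set
  DenseSub S = ∀ x y → S x → S y → x < y → ∃ λ z → S z × x < z × z < y

  AtLeastTwo : Subset A → Set
  AtLeastTwo S = Σ A λ x → Σ A λ y → S x × S y × x ≢ y

  Scattered : Set₁
  Scattered = ∀ (S : Subset A) → AtLeastTwo S → ¬ DenseSub S

  SetLt : Subset A → Subset A → Set
  SetLt X Y = ∀ x y → X x → Y y → x < y

  IntervalsMeetEmpty : Subset A → Subset A → Set
  IntervalsMeetEmpty X Y = ¬ (∃ λ z → ∀ x y → X x → Y y → (x < z) × (z < y))

module _ {A : Set} (R : Rel A 0ℓ) where

  SqSub : Subset A → Set
  SqSub X = ∀ x x' → X x → X x' → R x x'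

  UnionSqSub : Subset A → Subset A → Set
  UnionSqSub X Y = ∀ u v → (X u ⊎ Y u) → (X v ⊎ Y v) → R u v

{-# OPTIONS --safe #-}
-- Call [l, r] homogeneous when all of its points are R-related. A non-homogeneous
-- [l, r] has a point m ∈ ]l, r[ splitting it into two non-homogeneous halves:
-- otherwise X = {u ∈ [l, r] ∣ [l, u] homogeneous} and Y = [l, r] ∖ X satisfy X < Y,
-- each is R-related to one endpoint, and no point lies strictly between them, so the
-- hypothesis glues them and [l, r] is homogeneous after all. Splitting both halves
-- again and again produces a binary tree of midpoints, which is a dense suborder.
module Submission where

open import Defs
open import Level using (0ℓ)
open import Axiom.ExcludedMiddle using (ExcludedMiddle)
open import Relation.Binary using (Rel; IsStrictTotalOrder; IsEquivalence)
open import Relation.Binary.PropositionalEquality using (_≡_; refl)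
open import Relation.Binary.Structures using (IsStrictPartialOrder; IsPartialOrder)
open import Relation.Binary.Definitions using (tri<; tri≈; tri>)
import Relation.Binary.Construct.StrictToNonStrict as StrictToNonStrict
open import Data.Product using (∃; _×_; _,_; proj₁; proj₂; map)
open import Function using (id)
open import Data.Sum using (_⊎_; inj₁; inj₂)
open import Relation.Nullary using (¬_; yes; no)
open import Relation.Nullary.Decidable using (decidable-stable)
open import Relation.Nullary.Negation using (contradiction)

record Bisection {A : Set} (_<_ : Rel A 0ℓ) (I : A → A → Set) (l r : A) : Set where
  field
    mid   : A
    l<mid : l < mid
    mid<r : mid < r
    lower : I l mid
    upper : I mid r

data Path : Set where
  here       : Path
  left right : Path → Path

module BisectionTree {A : Set} {_<_ : Rel A 0ℓ} (spo : IsStrictPartialOrder _≡_ _<_)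
                     (I : A → A → Set) (bisect : ∀ {l r} → I l r → Bisection _<_ I l r)
                     where
  open IsStrictPartialOrder spo using (irrefl; trans; asym)
  open module Bisect {l r} (i : I l r) = Bisection (bisect i)

  node : ∀ {l r} → I l r → Path → A
  node i here      = mid i
  node i (left p)  = node (lower i) p
  node i (right p) = node (upper i) p

  node-above : ∀ {l r} (i : I l r) p → l < node i p
  node-above i here      = l<mid i
  node-above i (left p)  = node-above (lower i) p
  node-above i (right p) = trans (l<mid i) (node-above (upper i) p)

  node-below : ∀ {l r} (i : I l r) p → node i p < r
  node-below i here      = mid<r i
  node-below i (left p)  = trans (node-below (lower i) p) (mid<r i)
  node-below i (right p) = node-below (upper i) p

  NodeBetween : ∀ {l r} → I l r → A → A → Set
  NodeBetween i a b = ∃ λ w → a < node i w × node i w < b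

  node-between-lower : ∀ {l r} (i : I l r) q → NodeBetween i l (node i q)
  node-between-lower i here      = left here , l<mid (lower i) , mid<r (lower i)
  node-between-lower i (left q)  = map left id (node-between-lower (lower i) q)
  node-between-lower i (right q) = here , l<mid i , node-above (upper i) q

  node-between-upper : ∀ {l r} (i : I l r) p → NodeBetween i (node i p) r
  node-between-upper i here      = right here , l<mid (upper i) , mid<r (upper i)
  node-between-upper i (left p)  = here , node-below (lower i) p , mid<r i
  node-between-upper i (right p) = map right id (node-between-upper (upper i) p)

  node-between : ∀ {l r} (i : I l r) p q → node i p < node i q →
                 NodeBetween i (node i p) (node i q)
  node-between i here      here      p<q = contradiction p<q (irrefl refl)
  node-between i here      (left q)  p<q = contradiction p<q (asym (node-below (lower i) q))
  node-between i here      (right q) _   = map right id (node-between-lower (upper i) q)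
  node-between i (left p)  here      _   = map left id (node-between-upper (lower i) p)
  node-between i (left p)  (left q)  p<q = map left id (node-between (lower i) p q p<q)
  node-between i (left p)  (right q) _   = here , node-below (lower i) p , node-above (upper i) q
  node-between i (right p) here      p<q = contradiction p<q (asym (node-above (upper i) p))
  node-between i (right p) (left q)  p<q =
    contradiction p<q (asym (trans (node-below (lower i) q) (node-above (upper i) p)))
  node-between i (right p) (right q) p<q = map right id (node-between (upper i) p q p<q)

  Nodes : ∀ {l r} → I l r → Subset A
  Nodes i z = ∃ λ p → node i p ≡ z

  nodes-dense : ∀ {l r} (i : I l r) → DenseSub _<_ (Nodes i)
  nodes-dense i _ _ (p , refl) (q , refl) p<q with node-between i p q p<q
  ... | w , between = node i w , (w , refl) , between

  nodes-atLeastTwo : ∀ {l r} (i : I l r) → AtLeastTwo _<_ (Nodes i)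
  nodes-atLeastTwo i = node i (left here) , node i here , (left here , refl) , (here , refl) ,
                       λ eq → irrefl eq (node-below (lower i) here)

  ¬scattered : ∀ {l r} → I l r → ¬ Scattered _<_
  ¬scattered i scattered = scattered (Nodes i) (nodes-atLeastTwo i) (nodes-dense i)

module Homogeneity (em : ExcludedMiddle 0ℓ) {A : Set} {_<_ : Rel A 0ℓ}
                   (sto : IsStrictTotalOrder _≡_ _<_) {R : Rel A 0ℓ} (isEq : IsEquivalence R)
                   (glue : ∀ (X Y : Subset A) → SetLt _<_ X Y → SqSub R X → SqSub R Y →
                             IntervalsMeetEmpty _<_ X Y → UnionSqSub R X Y)
                   where
  open IsStrictTotalOrder sto using (compare; irrefl; asym; isStrictPartialOrder)
  open StrictToNonStrict _≡_ _<_ using (_≤_)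
  open IsPartialOrder (StrictToNonStrict.isPartialOrder _≡_ _<_ isStrictPartialOrder)
    using (antisym) renaming (refl to ≤-refl; trans to ≤-trans)
  open IsEquivalence isEq renaming (refl to R-refl; sym to R-sym; trans to R-trans)

  <⇒≱ : ∀ {a b} → a < b → ¬ b ≤ a
  <⇒≱ a<b (inj₁ b<a)  = asym a<b b<a
  <⇒≱ a<b (inj₂ refl) = irrefl refl a<b

  related-to⇒sqSub : ∀ {X : Subset A} c → (∀ u → X u → R c u) → SqSub R X
  related-to⇒sqSub c related u v Xu Xv = R-trans (R-sym (related u Xu)) (related v Xv)

  Interval : A → A → Subset A
  Interval l r u = l ≤ u × u ≤ r

  Homogeneous : A → A → Set
  Homogeneous l r = SqSub R (Interval l r)

  Inhomogeneous : A → A → Set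
  Inhomogeneous l r = ¬ Homogeneous l r

  homogeneous-refl : ∀ l → Homogeneous l l
  homogeneous-refl l u v (l≤u , u≤l) (l≤v , v≤l)
    rewrite antisym u≤l l≤u | antisym v≤l l≤v = R-refl

  homogeneous-shrink : ∀ {l r r′} → r′ ≤ r → Homogeneous l r → Homogeneous l r′
  homogeneous-shrink r′≤r h u v (l≤u , u≤r′) (l≤v , v≤r′) =
    h u v (l≤u , ≤-trans u≤r′ r′≤r) (l≤v , ≤-trans v≤r′ r′≤r)

  homogeneous⇒related : ∀ {l r} → l ≤ r → Homogeneous l r → R l r
  homogeneous⇒related l≤r h = h _ _ (≤-refl , l≤r) (l≤r , ≤-refl)

  inhomogeneous⇒< : ∀ {l r} → Inhomogeneous l r → l < r
  inhomogeneous⇒< {l} {r} ¬h with compare l r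
  ... | tri< l<r _ _ = l<r
  ... | tri≈ _ refl _ = contradiction (homogeneous-refl l) ¬h
  ... | tri> _ _ r<l = contradiction (λ _ _ (l≤u , u≤r) _ → contradiction (≤-trans l≤u u≤r) (<⇒≱ r<l)) ¬h

  Bisectable : A → A → Set
  Bisectable = Bisection _<_ Inhomogeneous

  inhomogeneous⇒¬¬bisectable : ∀ {l r} → Inhomogeneous l r → ¬ ¬ Bisectable l r
  inhomogeneous⇒¬¬bisectable {l} {r} ¬h ¬b = ¬h λ u v lr-u lr-v →
    glue X Y X<Y X-homogeneous Y-homogeneous nothing-between u v (classify lr-u) (classify lr-v)
    where
    l≤r : l ≤ r
    l≤r = inj₁ (inhomogeneous⇒< ¬h)

    X Y : Subset A
    X u = Interval l r u × Homogeneous l u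
    Y u = Interval l r u × Inhomogeneous l u

    classify : ∀ {u} → Interval l r u → X u ⊎ Y u
    classify {u} lr-u with em {Homogeneous l u}
    ... | yes h  = inj₁ (lr-u , h)
    ... | no ¬hu = inj₂ (lr-u , ¬hu)

    l∈X : X l
    l∈X = (≤-refl , l≤r) , homogeneous-refl l

    r∈Y : Y r
    r∈Y = (l≤r , ≤-refl) , ¬h

    X-homogeneous : SqSub R X
    X-homogeneous = related-to⇒sqSub l λ { u ((l≤u , _) , h) → homogeneous⇒related l≤u h }

    -- [u, r] is homogeneous, for otherwise u would bisect [l, r].
    Y-related : ∀ u → Y u → R u r
    Y-related u ((_ , inj₂ refl) , _)   = R-refl
    Y-related u ((_ , inj₁ u<r) , ¬hu) = homogeneous⇒related (inj₁ u<r)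
      (decidable-stable em λ ¬hur → ¬b (record
        { mid = u ; l<mid = inhomogeneous⇒< ¬hu ; mid<r = u<r ; lower = ¬hu ; upper = ¬hur }))

    Y-homogeneous : SqSub R Y
    Y-homogeneous = related-to⇒sqSub r λ u Yu → R-sym (Y-related u Yu)

    X<Y : SetLt _<_ X Y
    X<Y u v (_ , hu) (_ , ¬hv) with compare u v
    ... | tri< u<v _ _ = u<v
    ... | tri≈ _ refl _ = contradiction hu ¬hv
    ... | tri> _ _ v<u = contradiction (homogeneous-shrink (inj₁ v<u) hu) ¬hv

    nothing-between : IntervalsMeetEmpty _<_ X Y
    nothing-between (z , between) with between l r l∈X r∈Y
    ... | l<z , z<r with classify (inj₁ l<z , inj₁ z<r)
    ... | inj₁ z∈X = irrefl refl (proj₁ (between z r z∈X r∈Y))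
    ... | inj₂ z∈Y = irrefl refl (proj₂ (between l z l∈X z∈Y))

  bisect : ∀ {l r} → Inhomogeneous l r → Bisectable l r
  bisect ¬h = decidable-stable em (inhomogeneous⇒¬¬bisectable ¬h)

  homogeneous : Scattered _<_ → ∀ l r → Homogeneous l r
  homogeneous scattered l r = decidable-stable em λ ¬h →
    BisectionTree.¬scattered isStrictPartialOrder Inhomogeneous bisect ¬h scattered

  related : Scattered _<_ → ∀ x y → R x y
  related scattered x y with compare x y
  ... | tri< x<y _ _ = homogeneous⇒related (inj₁ x<y) (homogeneous scattered x y)
  ... | tri≈ _ refl _ = R-refl
  ... | tri> _ _ y<x = R-sym (homogeneous⇒related (inj₁ y<x) (homogeneous scattered y x))

lemma7 : ExcludedMiddle 0ℓ →
    (A : Set) (_<_ : Rel A 0ℓ) → IsStrictTotalOrder _≡_ _<_ →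
    Scattered _<_ →
    (R : Rel A 0ℓ) → IsEquivalence R →
    (∀ (X Y : Subset A) → SetLt _<_ X Y → SqSub R X → SqSub R Y →
    IntervalsMeetEmpty _<_ X Y → UnionSqSub R X Y) →
    ∀ x y → R x y
lemma7 em _ _ sto scattered _ isEq glue = Homogeneity.related em sto isEq glue scattered
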